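{- Let $M$ be a matroid such that for all cyclic flats $A,B$ of $M$, the pair $(A,B)$ is modular and $A\cap B$ is a cyclic flat of $M$. Then $M$ is configuration unique.
   Context: A cyclic flat is a flat that is a (possibly empty) union of circuits; the cyclic flats of $M$ form a lattice $\mathcal{Z}(M)$ under inclusion. A pair $(X,Y)$ is modular if $r(X)+r(Y)=r(X\cup Y)+r(X\cap Y)$. Matroids $M,N$ have the same configuration if $|E(M)|=|E(N)|$ and there is a lattice isomorphism $\Phi:\mathcal{Z}(M)\to\mathcal{Z}(N)$ with $|\Phi(F)|=|F|$ and $r_N(\Phi(F))=r_M(F)$ for all $F$; $M$ is configuration unique if every matroid with the same configuration as $M$ is isomorphic to $M$. -}

module Defs where

open import Data.Nat using (ℕ; _≤_; _<_; _+_)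
open import Data.Fin using (Fin)
open import Data.Fin.Subset using (Subset; _∈_; _∉_; _⊆_; _⊂_; _∩_; _∪_; ⁅_⁆; ∣_∣)
open import Data.Vec using (tabulate; lookup)
open import Data.Product using (Σ; ∃; _×_)
open import Function.Bundles using (_↔_; Inverse)
open import Relation.Binary.PropositionalEquality using (_≡_)

record Matroid (n : ℕ) : Set where
  field
    r         : Subset n → ℕ
    r-bounded : ∀ X → r X ≤ ∣ X ∣
    r-mono    : ∀ X Y → X ⊆ Y → r X ≤ r Y
    r-submod  : ∀ X Y → r (X ∪ Y) + r (X ∩ Y) ≤ r X + r Y

open Matroid public

module _ {n : ℕ} (M : Matroid n) where

  IsFlat : Subset n → Set
  IsFlat F = ∀ e → r M (F ∪ ⁅ e ⁆) ≡ r M F → e ∈ F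

  IsDependent : Subset n → Set
  IsDependent C = r M C < ∣ C ∣

  IsCircuit : Subset n → Set
  IsCircuit C = IsDependent C × (∀ D → D ⊂ C → r M D ≡ ∣ D ∣)

  IsUnionOfCircuits : Subset n → Set
  IsUnionOfCircuits F = ∀ e → e ∈ F → Σ (Subset n) λ C → IsCircuit C × e ∈ C × C ⊆ F

  IsCyclicFlat : Subset n → Set
  IsCyclicFlat F = IsFlat F × IsUnionOfCircuits F

  IsModularPair : Subset n → Subset n → Set
  IsModularPair X Y = r M X + r M Y ≡ r M (X ∪ Y) + r M (X ∩ Y)

image : {n m : ℕ} → (Fin n ↔ Fin m) → Subset n → Subset m
image σ X = tabulate (λ j → lookup X (Inverse.from σ j))

Isomorphic : {n m : ℕ} → Matroid n → Matroid m → Set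
Isomorphic {n} {m} M N =
  Σ (Fin n ↔ Fin m) λ σ → ∀ X → r N (image σ X) ≡ r M X

-- A lattice isomorphism Z(M) → Z(N) between lattices of cyclic flats,
-- i.e. an order isomorphism (bijection Φ with inverse Ψ, both monotone
-- w.r.t. inclusion), preserving size and rank.
record ConfigIso {n m : ℕ} (M : Matroid n) (N : Matroid m) : Set where
  field
    Φ        : Subset n → Subset m
    Ψ        : Subset m → Subset n
    Φ-cyc    : ∀ F → IsCyclicFlat M F → IsCyclicFlat N (Φ F)
    Ψ-cyc    : ∀ G → IsCyclicFlat N G → IsCyclicFlat M (Ψ G)
    ΨΦ       : ∀ F → IsCyclicFlat M F → Ψ (Φ F) ≡ F
    ΦΨ       : ∀ G → IsCyclicFlat N G → Φ (Ψ G) ≡ G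
    Φ-mono   : ∀ A B → IsCyclicFlat M A → IsCyclicFlat M B → A ⊆ B → Φ A ⊆ Φ B
    Ψ-mono   : ∀ A B → IsCyclicFlat N A → IsCyclicFlat N B → A ⊆ B → Ψ A ⊆ Ψ B
    Φ-size   : ∀ F → IsCyclicFlat M F → ∣ Φ F ∣ ≡ ∣ F ∣
    Φ-rank   : ∀ F → IsCyclicFlat M F → r N (Φ F) ≡ r M F

SameConfiguration : {n m : ℕ} → Matroid n → Matroid m → Set
SameConfiguration {n} {m} M N = (n ≡ m) × ConfigIso M N

ConfigurationUnique : {n : ℕ} → Matroid n → Set
ConfigurationUnique {n} M =
  ∀ (m : ℕ) (N : Matroid m) → SameConfiguration M N → Isomorphic M N

{-# OPTIONS --safe #-}
module Submission where

-- The rank of every set is determined by the cyclic flats: r(X) is the minimum of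
-- r(F) + |X ─ F| over all cyclic flats F.  So it suffices to find a permutation σ of the
-- ground set with σ(F) = Φ(F) for every cyclic flat F.
-- Under the hypothesis Φ commutes with intersections.  Deleting coloops from Φ(A) ∩ Φ(B)
-- and closing leaves a cyclic flat C ⊇ Φ(A ∩ B) with r(C) + |Φ(A) ∩ Φ(B) ─ C| bounded by
-- r(Φ(A) ∩ Φ(B)), and modularity of (A , B) bounds this by r(A ∩ B) = r(Φ(A ∩ B)) ≤ r(C).
-- So Φ(A) ∩ Φ(B) ⊆ C, and C ⊆ Φ(A ∩ B) because Φ is an order isomorphism.
-- Hence every intersection of cyclic flats has the same size as its image under Φ, by
-- inclusion–exclusion so does every atom of the Boolean algebra they generate, and matching
-- the atoms gives σ.

open import Algebra.Bundles using (CommutativeMonoid)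
import Algebra.Properties.CommutativeSemigroup as CommutativeSemigroupProperties
open import Data.Bool.Base using (Bool; true; false; _∧_; not; T)
import Data.Bool.Properties as Bool
open import Data.Empty using (⊥-elim)
open import Data.Fin.Base using (Fin; zero; suc; punchIn)
open import Data.Fin.Properties using (any?; all?) renaming (_≟_ to _≟ᶠ_)
open import Data.Fin.Permutation
  using (Permutation; _⟨$⟩ʳ_; _⟨$⟩ˡ_; inverseˡ; inverseʳ; insert; insert-punchIn)
  renaming (id to idₚ)
open import Data.Fin.Subset
open import Data.Fin.Subset.Properties
open import Data.Fin.Subset.Induction using (⊂-wellFounded; ⊃-wellFounded)
open import Data.List.Base using (List; []; _∷_; [_]; _++_; length) renaming (map to mapₗ)
open import Data.List.Membership.Propositional using () renaming (_∈_ to _∈ₗ_)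
open import Data.List.Membership.Propositional.Properties using (∈-++⁺ˡ; ∈-++⁺ʳ; ∈-map⁺)
open import Data.List.Relation.Unary.Any using (here; there)
open import Data.Nat.Base using (ℕ; zero; suc; _+_; _≤_; _<_; z≤n; s≤s)
open import Data.Nat.Properties
open import Algebra.Properties.CommutativeMonoid.Sum +-0-commutativeMonoid
  using (sum; sum-permute; sum-remove; sum-cong-≗)
open import Data.Product using (Σ; ∃; _×_; _,_; proj₁; proj₂)
import Data.Product as Product
open import Data.Sum using (inj₁; inj₂; [_,_]′)
open import Data.Unit using (tt)
open import Data.Vec.Base using (Vec; []; _∷_; lookup; tabulate; zipWith; here; there)
open import Data.Vec.Properties
  using (≡-dec; ∷-injective; lookup-zipWith; lookup-map; lookup-replicate;
         lookup∘tabulate; tabulate∘lookup; tabulate-cong)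
open import Function.Base using (_∘_; id)
open import Induction.WellFounded using (Acc; acc)
open import Relation.Binary.Definitions using (DecidableEquality)
open import Relation.Binary.PropositionalEquality
  using (_≡_; _≢_; _≗_; refl; sym; trans; cong; cong₂; subst; module ≡-Reasoning)
open import Relation.Nullary using (Dec; yes; no; does; contradiction)
open import Relation.Nullary.Decidable
  using (_×-dec_; _→-dec_; ¬?; map′; dec-true; decidable-stable)
open import Relation.Unary using (Decidable)

open import Defs

private
  variable
    n m : ℕ

-- Subsets

x∈p─q⁻ : ∀ {x : Fin n} (p q : Subset n) → x ∈ p ─ q → x ∈ p × x ∉ q
x∈p─q⁻ {x = zero} (true ∷ p) (false ∷ q) here = here , λ ()
x∈p─q⁻ {x = zero} (false ∷ p) (false ∷ q) ()
x∈p─q⁻ {x = zero} (_ ∷ p) (true ∷ q) ()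
x∈p─q⁻ {x = suc x} (_ ∷ p) (_ ∷ q) (there x∈p─q) =
  Product.map there (λ x∉q → x∉q ∘ drop-there) (x∈p─q⁻ p q x∈p─q)

p⊆q∪[p─q] : ∀ (p q : Subset n) → p ⊆ q ∪ (p ─ q)
p⊆q∪[p─q] p q {x} x∈p with x ∈? q
... | yes x∈q = x∈p∪q⁺ (inj₁ x∈q)
... | no x∉q = x∈p∪q⁺ (inj₂ (x∈p∧x∉q⇒x∈p─q x∈p x∉q))

p⊆[p-x]∪q : ∀ {x : Fin n} {p q : Subset n} → x ∈ q → p ⊆ (p - x) ∪ q
p⊆[p-x]∪q {x = x} x∈q {y} y∈p with y ≟ᶠ x
... | yes refl = x∈p∪q⁺ (inj₂ x∈q)
... | no y≢x = x∈p∪q⁺ (inj₁ (x∈p∧x≢y⇒x∈p-y y∈p y≢x))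

∣p∣≡∣p∩q∣+∣p─q∣ : ∀ (p q : Subset n) → ∣ p ∣ ≡ ∣ p ∩ q ∣ + ∣ p ─ q ∣
∣p∣≡∣p∩q∣+∣p─q∣ [] [] = refl
∣p∣≡∣p∩q∣+∣p─q∣ (true ∷ p) (true ∷ q) = cong suc (∣p∣≡∣p∩q∣+∣p─q∣ p q)
∣p∣≡∣p∩q∣+∣p─q∣ (true ∷ p) (false ∷ q) =
  trans (cong suc (∣p∣≡∣p∩q∣+∣p─q∣ p q)) (sym (+-suc _ _))
∣p∣≡∣p∩q∣+∣p─q∣ (false ∷ p) (true ∷ q) = ∣p∣≡∣p∩q∣+∣p─q∣ p q
∣p∣≡∣p∩q∣+∣p─q∣ (false ∷ p) (false ∷ q) = ∣p∣≡∣p∩q∣+∣p─q∣ p q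

∣p∣≡∣q∩p∣+∣∁q∩p∣ : ∀ (p q : Subset n) → ∣ p ∣ ≡ ∣ q ∩ p ∣ + ∣ ∁ q ∩ p ∣
∣p∣≡∣q∩p∣+∣∁q∩p∣ [] [] = refl
∣p∣≡∣q∩p∣+∣∁q∩p∣ (true ∷ p) (true ∷ q) = cong suc (∣p∣≡∣q∩p∣+∣∁q∩p∣ p q)
∣p∣≡∣q∩p∣+∣∁q∩p∣ (true ∷ p) (false ∷ q) =
  trans (cong suc (∣p∣≡∣q∩p∣+∣∁q∩p∣ p q)) (sym (+-suc _ _))
∣p∣≡∣q∩p∣+∣∁q∩p∣ (false ∷ p) (true ∷ q) = ∣p∣≡∣q∩p∣+∣∁q∩p∣ p q
∣p∣≡∣q∩p∣+∣∁q∩p∣ (false ∷ p) (false ∷ q) = ∣p∣≡∣q∩p∣+∣∁q∩p∣ p q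

∣p∣≤1+∣p-x∣ : ∀ (p : Subset n) x → ∣ p ∣ ≤ 1 + ∣ p - x ∣
∣p∣≤1+∣p-x∣ p x = begin
  ∣ p ∣                      ≡⟨ ∣p∣≡∣p∩q∣+∣p─q∣ p ⁅ x ⁆ ⟩
  ∣ p ∩ ⁅ x ⁆ ∣ + ∣ p - x ∣  ≤⟨ +-monoˡ-≤ _ (≤-trans (∣p∩q∣≤∣q∣ p ⁅ x ⁆) (≤-reflexive (∣⁅x⁆∣≡1 x))) ⟩
  1 + ∣ p - x ∣              ∎
  where open ≤-Reasoning

∣p─p∣≡0 : ∀ (p : Subset n) → ∣ p ─ p ∣ ≡ 0
∣p─p∣≡0 [] = refl
∣p─p∣≡0 (true ∷ p) = ∣p─p∣≡0 p
∣p─p∣≡0 (false ∷ p) = ∣p─p∣≡0 p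

∣p─q∣≡0⇒p⊆q : ∀ {p q : Subset n} → ∣ p ─ q ∣ ≡ 0 → p ⊆ q
∣p─q∣≡0⇒p⊆q {p = p} {q} ∣p─q∣≡0 {x} x∈p with x ∈? q
... | yes x∈q = x∈q
... | no x∉q =
  ⊥-elim (n≮0 (subst (∣ p ─ q - x ∣ <_) ∣p─q∣≡0 (x∈p⇒∣p-x∣<∣p∣ (x∈p∧x∉q⇒x∈p─q x∈p x∉q))))

q⊆s⇒p─s⊆p─q : ∀ {p q s : Subset n} → q ⊆ s → p ─ s ⊆ p ─ q
q⊆s⇒p─s⊆p─q {p = p} {s = s} q⊆s x∈p─s =
  let (x∈p , x∉s) = x∈p─q⁻ p s x∈p─s in x∈p∧x∉q⇒x∈p─q x∈p (x∉s ∘ q⊆s)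

module _ {n : ℕ} where
  open CommutativeSemigroupProperties (CommutativeMonoid.commutativeSemigroup (∩-commutativeMonoid n))
    using (x∙yz≈y∙xz)

  p∩[q∩s]≡[q∩p]∩s : ∀ (p q s : Subset n) → p ∩ (q ∩ s) ≡ (q ∩ p) ∩ s
  p∩[q∩s]≡[q∩p]∩s p q s = trans (x∙yz≈y∙xz p q s) (sym (∩-assoc q p s))

  ∣p∩s∣≡∣p∩[q∩s]∣+∣p∩[∁q∩s]∣ : ∀ (p q s : Subset n) → ∣ p ∩ s ∣ ≡ ∣ p ∩ (q ∩ s) ∣ + ∣ p ∩ (∁ q ∩ s) ∣
  ∣p∩s∣≡∣p∩[q∩s]∣+∣p∩[∁q∩s]∣ p q s =
    trans (∣p∣≡∣q∩p∣+∣∁q∩p∣ (p ∩ s) q)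
          (cong₂ (λ u v → ∣ u ∣ + ∣ v ∣) (x∙yz≈y∙xz q p s) (x∙yz≈y∙xz (∁ q) p s))

-- Counting and permutations

fromBool : Bool → ℕ
fromBool false = 0
fromBool true = 1

count : (Fin n → Bool) → ℕ
count p = sum (fromBool ∘ p)

count-cong : ∀ {p q : Fin n → Bool} → p ≗ q → count p ≡ count q
count-cong p≗q = sum-cong-≗ (cong fromBool ∘ p≗q)

∣p∣≡count : ∀ (p : Subset n) → ∣ p ∣ ≡ count (lookup p)
∣p∣≡count [] = refl
∣p∣≡count (true ∷ p) = cong suc (∣p∣≡count p)
∣p∣≡count (false ∷ p) = ∣p∣≡count p

count>0⇒∃ : ∀ (p : Fin n → Bool) → 0 < count p → ∃ λ x → T (p x)
count>0⇒∃ {zero} p ()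
count>0⇒∃ {suc n} p pos with p zero in eq
... | true = zero , subst T (sym eq) tt
... | false = Product.map suc id (count>0⇒∃ (p ∘ suc) pos)

module _ {K : Set} (_≟_ : DecidableEquality K) where

  fibreSize : (Fin n → K) → K → ℕ
  fibreSize t k = count (λ x → does (t x ≟ k))

  permutation-matching-fibres : ∀ (t u : Fin n → K) → (∀ k → fibreSize t k ≡ fibreSize u k) →
                                Σ (Permutation n n) λ σ → ∀ x → u (σ ⟨$⟩ʳ x) ≡ t x
  permutation-matching-fibres {zero} t u _ = idₚ , λ ()
  permutation-matching-fibres {suc n} t u same = insert zero y σ , matches
    where
    t₀-counted : 0 < fibreSize t (t zero)
    t₀-counted rewrite dec-true (t zero ≟ t zero) refl = s≤s z≤n

    found : ∃ λ y → T (does (u y ≟ t zero))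
    found = count>0⇒∃ _ (subst (0 <_) (same (t zero)) t₀-counted)

    y : Fin (suc n)
    y = proj₁ found

    uy≡t₀ : u y ≡ t zero
    uy≡t₀ with u y ≟ t zero | proj₂ found
    ... | yes eq | _ = eq
    ... | no _ | ()

    same′ : ∀ k → fibreSize (t ∘ suc) k ≡ fibreSize (u ∘ punchIn y) k
    same′ k = +-cancelˡ-≡ (fromBool (does (t zero ≟ k))) _ _ (begin
      fibreSize t k                                          ≡⟨ same k ⟩
      fibreSize u k
        ≡⟨ sum-remove {i = y} (fromBool ∘ λ x → does (u x ≟ k)) ⟩
      fromBool (does (u y ≟ k)) + fibreSize (u ∘ punchIn y) k
        ≡⟨ cong (λ v → fromBool (does (v ≟ k)) + fibreSize (u ∘ punchIn y) k) uy≡t₀ ⟩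
      fromBool (does (t zero ≟ k)) + fibreSize (u ∘ punchIn y) k ∎)
      where open ≡-Reasoning

    rest : Σ (Permutation n n) λ σ → ∀ x → u (punchIn y (σ ⟨$⟩ʳ x)) ≡ t (suc x)
    rest = permutation-matching-fibres (t ∘ suc) (u ∘ punchIn y) same′

    σ : Permutation n n
    σ = proj₁ rest

    matches : ∀ x → u (insert zero y σ ⟨$⟩ʳ x) ≡ t x
    matches zero = uy≡t₀
    matches (suc x) = trans (cong u (insert-punchIn zero y σ x)) (proj₂ rest x)

lookup≗⇒≡ : ∀ {A : Set} (u w : Vec A n) → lookup u ≗ lookup w → u ≡ w
lookup≗⇒≡ u w eq = trans (sym (tabulate∘lookup u)) (trans (tabulate-cong eq) (tabulate∘lookup w))

module _ (σ : Permutation n m) where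

  image-zipWith : ∀ (f : Bool → Bool → Bool) X Y →
                  image σ (zipWith f X Y) ≡ zipWith f (image σ X) (image σ Y)
  image-zipWith f X Y = lookup≗⇒≡ _ _ λ j → begin
    lookup (image σ (zipWith f X Y)) j               ≡⟨ lookup∘tabulate _ j ⟩
    lookup (zipWith f X Y) (σ ⟨$⟩ˡ j)                ≡⟨ lookup-zipWith f (σ ⟨$⟩ˡ j) X Y ⟩
    f (lookup X (σ ⟨$⟩ˡ j)) (lookup Y (σ ⟨$⟩ˡ j))
      ≡⟨ cong₂ f (lookup∘tabulate _ j) (lookup∘tabulate _ j) ⟨
    f (lookup (image σ X) j) (lookup (image σ Y) j)  ≡⟨ lookup-zipWith f j (image σ X) (image σ Y) ⟨
    lookup (zipWith f (image σ X) (image σ Y)) j     ∎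
    where open ≡-Reasoning

  ∣image∣ : ∀ X → ∣ image σ X ∣ ≡ ∣ X ∣
  ∣image∣ X = begin
    ∣ image σ X ∣                        ≡⟨ ∣p∣≡count (image σ X) ⟩
    count (lookup (image σ X))           ≡⟨ count-cong (lookup∘tabulate (lookup X ∘ (σ ⟨$⟩ˡ_))) ⟩
    count (lookup X ∘ (σ ⟨$⟩ˡ_))          ≡⟨ sum-permute (fromBool ∘ lookup X ∘ (σ ⟨$⟩ˡ_)) σ ⟩
    count (lookup X ∘ (σ ⟨$⟩ˡ_) ∘ (σ ⟨$⟩ʳ_)) ≡⟨ count-cong (λ i → cong (lookup X) (inverseˡ σ {i})) ⟩
    count (lookup X)                     ≡⟨ ∣p∣≡count X ⟨
    ∣ X ∣                                ∎
    where open ≡-Reasoning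

  ∣image-─∣ : ∀ X Y → ∣ image σ X ─ image σ Y ∣ ≡ ∣ X ─ Y ∣
  ∣image-─∣ X Y = trans (cong ∣_∣ (sym (image-zipWith _ X Y))) (∣image∣ (X ─ Y))

  image-unique : ∀ X Y → (∀ x → lookup Y (σ ⟨$⟩ʳ x) ≡ lookup X x) → image σ X ≡ Y
  image-unique X Y eq =
    trans (tabulate-cong λ j → trans (sym (eq (σ ⟨$⟩ˡ j))) (cong (lookup Y) (inverseʳ σ)))
          (tabulate∘lookup Y)

-- Atoms of a finite family of subsets

literal : Bool → Subset n → Subset n
literal true X = X
literal false X = ∁ X

lookup-literal : ∀ c (X : Subset n) x → lookup (literal c X) x ≡ does (lookup X x Bool.≟ c)
lookup-literal true X x with lookup X x
... | true = refl
... | false = refl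
lookup-literal false X x with lookup X x | lookup-map x not X
... | true | eq = eq
... | false | eq = eq

_≟ᵇ_ : ∀ {k} → DecidableEquality (Vec Bool k)
_≟ᵇ_ = ≡-dec Bool._≟_

module _ {I : Set} (A : I → Subset n) where

  profile : (L : List I) → Fin n → Vec Bool (length L)
  profile [] x = []
  profile (i ∷ L) x = lookup (A i) x ∷ profile L x

  atom : (L : List I) → Vec Bool (length L) → Subset n
  atom [] [] = ⊤
  atom (i ∷ L) (c ∷ b) = literal c (A i) ∩ atom L b

  lookup-atom : ∀ L b x → lookup (atom L b) x ≡ does (profile L x ≟ᵇ b)
  lookup-atom [] [] x = lookup-replicate x true
  lookup-atom (i ∷ L) (c ∷ b) x =
    trans (lookup-zipWith _∧_ x (literal c (A i)) (atom L b))
          (cong₂ _∧_ (lookup-literal c (A i) x) (lookup-atom L b x))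

  ∣atom∣ : ∀ L b → ∣ atom L b ∣ ≡ fibreSize _≟ᵇ_ (profile L) b
  ∣atom∣ L b = trans (∣p∣≡count (atom L b)) (count-cong (lookup-atom L b))

lookup-profile : ∀ {I : Set} (A B : I → Subset n) {i L} → i ∈ₗ L → ∀ x y →
                 profile A L x ≡ profile B L y → lookup (A i) x ≡ lookup (B i) y
lookup-profile A B (here refl) x y eq = proj₁ (∷-injective eq)
lookup-profile A B (there i∈L) x y eq = lookup-profile A B i∈L x y (proj₂ (∷-injective eq))

module _ {I : Set} (A B : I → Subset n)
         (∣⋂A∣≡∣⋂B∣ : ∀ S → ∣ ⋂ (mapₗ A S) ∣ ≡ ∣ ⋂ (mapₗ B S) ∣) where

  -- Inclusion–exclusion on the first literal; the positive case is stated separately so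
  -- that the negative one can use it while the recursion stays structural.

  ∣⋂∩atom∣-equal : ∀ L S b → ∣ ⋂ (mapₗ A S) ∩ atom A L b ∣ ≡ ∣ ⋂ (mapₗ B S) ∩ atom B L b ∣
  ∣⋂∩[∩atom]∣-equal : ∀ i L S b → ∣ ⋂ (mapₗ A S) ∩ (A i ∩ atom A L b) ∣ ≡
                                   ∣ ⋂ (mapₗ B S) ∩ (B i ∩ atom B L b) ∣

  ∣⋂∩atom∣-equal [] S [] = begin
    ∣ ⋂ (mapₗ A S) ∩ ⊤ ∣  ≡⟨ cong ∣_∣ (∩-identityʳ (⋂ (mapₗ A S))) ⟩
    ∣ ⋂ (mapₗ A S) ∣      ≡⟨ ∣⋂A∣≡∣⋂B∣ S ⟩
    ∣ ⋂ (mapₗ B S) ∣      ≡⟨ cong ∣_∣ (∩-identityʳ (⋂ (mapₗ B S))) ⟨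
    ∣ ⋂ (mapₗ B S) ∩ ⊤ ∣  ∎
    where open ≡-Reasoning
  ∣⋂∩atom∣-equal (i ∷ L) S (true ∷ b) = ∣⋂∩[∩atom]∣-equal i L S b
  ∣⋂∩atom∣-equal (i ∷ L) S (false ∷ b) = +-cancelˡ-≡ ∣ U ∩ (A i ∩ P) ∣ _ _ (begin
    ∣ U ∩ (A i ∩ P) ∣ + ∣ U ∩ (∁ (A i) ∩ P) ∣   ≡⟨ ∣p∩s∣≡∣p∩[q∩s]∣+∣p∩[∁q∩s]∣ U (A i) P ⟨
    ∣ U ∩ P ∣                                   ≡⟨ ∣⋂∩atom∣-equal L S b ⟩
    ∣ U′ ∩ P′ ∣                                 ≡⟨ ∣p∩s∣≡∣p∩[q∩s]∣+∣p∩[∁q∩s]∣ U′ (B i) P′ ⟩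
    ∣ U′ ∩ (B i ∩ P′) ∣ + ∣ U′ ∩ (∁ (B i) ∩ P′) ∣
      ≡⟨ cong (_+ ∣ U′ ∩ (∁ (B i) ∩ P′) ∣) (∣⋂∩[∩atom]∣-equal i L S b) ⟨
    ∣ U ∩ (A i ∩ P) ∣ + ∣ U′ ∩ (∁ (B i) ∩ P′) ∣  ∎)
    where
    open ≡-Reasoning
    U = ⋂ (mapₗ A S)
    U′ = ⋂ (mapₗ B S)
    P = atom A L b
    P′ = atom B L b

  ∣⋂∩[∩atom]∣-equal i L S b = begin
    ∣ ⋂ (mapₗ A S) ∩ (A i ∩ atom A L b) ∣
      ≡⟨ cong ∣_∣ (p∩[q∩s]≡[q∩p]∩s (⋂ (mapₗ A S)) (A i) (atom A L b)) ⟩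
    ∣ ⋂ (mapₗ A (i ∷ S)) ∩ atom A L b ∣
      ≡⟨ ∣⋂∩atom∣-equal L (i ∷ S) b ⟩
    ∣ ⋂ (mapₗ B (i ∷ S)) ∩ atom B L b ∣
      ≡⟨ cong ∣_∣ (p∩[q∩s]≡[q∩p]∩s (⋂ (mapₗ B S)) (B i) (atom B L b)) ⟨
    ∣ ⋂ (mapₗ B S) ∩ (B i ∩ atom B L b) ∣  ∎
    where open ≡-Reasoning

  atom-permutation : ∀ L → Σ (Permutation n n) λ σ → ∀ {i} → i ∈ₗ L → image σ (A i) ≡ B i
  atom-permutation L = σ , λ {i} i∈L → image-unique σ (A i) (B i) λ x →
      sym (lookup-profile A B i∈L x (σ ⟨$⟩ʳ x) (sym (proj₂ matching x)))
    where
    open ≡-Reasoning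
    equal-fibres : ∀ b → fibreSize _≟ᵇ_ (profile A L) b ≡ fibreSize _≟ᵇ_ (profile B L) b
    equal-fibres b = begin
      fibreSize _≟ᵇ_ (profile A L) b  ≡⟨ ∣atom∣ A L b ⟨
      ∣ atom A L b ∣                  ≡⟨ cong ∣_∣ (∩-identityˡ (atom A L b)) ⟨
      ∣ ⊤ ∩ atom A L b ∣              ≡⟨ ∣⋂∩atom∣-equal L [] b ⟩
      ∣ ⊤ ∩ atom B L b ∣              ≡⟨ cong ∣_∣ (∩-identityˡ (atom B L b)) ⟩
      ∣ atom B L b ∣                  ≡⟨ ∣atom∣ B L b ⟩
      fibreSize _≟ᵇ_ (profile B L) b  ∎
    matching : Σ (Permutation n n) λ σ → ∀ x → profile B L (σ ⟨$⟩ʳ x) ≡ profile A L x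
    matching = permutation-matching-fibres _≟ᵇ_ (profile A L) (profile B L) equal-fibres
    σ : Permutation n n
    σ = proj₁ matching

module _ {I : Set} (_⊓_ : I → I → I) where

  ⋀ : I → List I → I
  ⋀ i [] = i
  ⋀ i (j ∷ S) = i ⊓ ⋀ j S

  ⋂-map-⋀ : ∀ (A : I → Subset n) → (∀ i j → A (i ⊓ j) ≡ A i ∩ A j) →
            ∀ i S → ⋂ (mapₗ A (i ∷ S)) ≡ A (⋀ i S)
  ⋂-map-⋀ A A-⊓ i [] = ∩-identityʳ (A i)
  ⋂-map-⋀ A A-⊓ i (j ∷ S) = trans (cong (A i ∩_) (⋂-map-⋀ A A-⊓ j S)) (sym (A-⊓ i (⋀ j S)))

  ∣⋂∣-equal : ∀ (A B : I → Subset n) →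
              (∀ i j → A (i ⊓ j) ≡ A i ∩ A j) → (∀ i j → B (i ⊓ j) ≡ B i ∩ B j) →
              (∀ i → ∣ A i ∣ ≡ ∣ B i ∣) → ∀ S → ∣ ⋂ (mapₗ A S) ∣ ≡ ∣ ⋂ (mapₗ B S) ∣
  ∣⋂∣-equal A B A-⊓ B-⊓ ∣A∣≡∣B∣ [] = refl
  ∣⋂∣-equal A B A-⊓ B-⊓ ∣A∣≡∣B∣ (i ∷ S) = begin
    ∣ ⋂ (mapₗ A (i ∷ S)) ∣  ≡⟨ cong ∣_∣ (⋂-map-⋀ A A-⊓ i S) ⟩
    ∣ A (⋀ i S) ∣           ≡⟨ ∣A∣≡∣B∣ (⋀ i S) ⟩
    ∣ B (⋀ i S) ∣           ≡⟨ cong ∣_∣ (⋂-map-⋀ B B-⊓ i S) ⟨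
    ∣ ⋂ (mapₗ B (i ∷ S)) ∣  ∎
    where open ≡-Reasoning

enumerate : ∀ {P : Subset n → Set} → Decidable P → List (Σ (Subset n) P)
enumerate {zero} P? with P? []
... | yes p = [ ([] , p) ]
... | no _ = []
enumerate {suc n} P? =
  mapₗ (Product.map (inside ∷_) id) (enumerate (P? ∘ (inside ∷_))) ++
  mapₗ (Product.map (outside ∷_) id) (enumerate (P? ∘ (outside ∷_)))

∈-enumerate : ∀ {P : Subset n → Set} (P? : Decidable P) {p} → P p → ∃ λ q → (p , q) ∈ₗ enumerate P?
∈-enumerate {zero} P? {[]} q with P? []
... | yes q′ = q′ , here refl
... | no ¬q = contradiction q ¬q
∈-enumerate {suc n} P? {inside ∷ p} q =
  Product.map id (∈-++⁺ˡ ∘ ∈-map⁺ (Product.map (inside ∷_) id)) (∈-enumerate (P? ∘ (inside ∷_)) q)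
∈-enumerate {suc n} P? {outside ∷ p} q =
  Product.map id (∈-++⁺ʳ _ ∘ ∈-map⁺ (Product.map (outside ∷_) id)) (∈-enumerate (P? ∘ (outside ∷_)) q)

-- Matroids

module _ (M : Matroid n) where

  r-submod-⊆ : ∀ {U V X Y} → U ⊆ X ∪ Y → V ⊆ X ∩ Y → r M U + r M V ≤ r M X + r M Y
  r-submod-⊆ {U} {V} {X} {Y} U⊆X∪Y V⊆X∩Y =
    ≤-trans (+-mono-≤ (r-mono M U _ U⊆X∪Y) (r-mono M V _ V⊆X∩Y)) (r-submod M X Y)

  r≤r+∣─∣ : ∀ X F → r M X ≤ r M F + ∣ X ─ F ∣
  r≤r+∣─∣ X F = begin
    r M X                      ≤⟨ m≤m+n (r M X) (r M (F ∩ (X ─ F))) ⟩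
    r M X + r M (F ∩ (X ─ F))  ≤⟨ r-submod-⊆ (p⊆q∪[p─q] X F) ⊆-refl ⟩
    r M F + r M (X ─ F)        ≤⟨ +-monoʳ-≤ (r M F) (r-bounded M (X ─ F)) ⟩
    r M F + ∣ X ─ F ∣          ∎
    where open ≤-Reasoning

  dependent⇒nonempty : ∀ {C} → IsDependent M C → Nonempty C
  dependent⇒nonempty {C} dep with nonempty? C
  ... | yes nonempty = nonempty
  ... | no empty =
    ⊥-elim (n≮0 (subst (r M C <_) (trans (cong ∣_∣ (Empty-unique empty)) (∣⊥∣≡0 n)) dep))

  ∃-circuit⊆ : ∀ {D} → IsDependent M D → ∃ λ C → IsCircuit M C × C ⊆ D
  ∃-circuit⊆ = go (⊂-wellFounded _)
    where
    go : ∀ {D} → Acc _⊂_ D → IsDependent M D → ∃ λ C → IsCircuit M C × C ⊆ D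
    go {D} (acc smaller) dep with anySubset? (λ D′ → D′ ⊂? D ×-dec (r M D′ <? ∣ D′ ∣))
    ... | yes (D′ , D′⊂D , dep′) =
      let (C , circuit , C⊆D′) = go (smaller D′⊂D) dep′ in C , circuit , ⊆-trans C⊆D′ (p⊂q⇒p⊆q D′⊂D)
    ... | no ∄dependent⊂D = D , (dep , independent) , ⊆-refl
      where
      independent : ∀ D′ → D′ ⊂ D → r M D′ ≡ ∣ D′ ∣
      independent D′ D′⊂D =
        ≤-antisym (r-bounded M D′) (≮⇒≥ λ dep′ → ∄dependent⊂D (D′ , D′⊂D , dep′))

  circuit⇒r[F-e]≡r[F] : ∀ {C F e} → IsCircuit M C → e ∈ C → C ⊆ F → r M (F - e) ≡ r M F
  circuit⇒r[F-e]≡r[F] {C} {F} {e} (dep , minimal) e∈C C⊆F =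
    ≤-antisym (r-mono M _ _ (p─q⊆p F ⁅ e ⁆)) (+-cancelʳ-≤ (r M (C - e)) _ _ (begin
      r M F + r M (C - e)        ≤⟨ r-submod-⊆ (p⊆[p-x]∪q e∈C) C-e⊆[F-e]∩C ⟩
      r M (F - e) + r M C        ≤⟨ +-monoʳ-≤ (r M (F - e)) r[C]≤r[C-e] ⟩
      r M (F - e) + r M (C - e)  ∎))
    where
    open ≤-Reasoning
    C-e⊆[F-e]∩C : C - e ⊆ (F - e) ∩ C
    C-e⊆[F-e]∩C x∈C-e =
      let (x∈C , x∉⁅e⁆) = x∈p─q⁻ C ⁅ e ⁆ x∈C-e in x∈p∩q⁺ (x∈p∧x∉q⇒x∈p─q (C⊆F x∈C) x∉⁅e⁆ , x∈C)
    r[C]≤r[C-e] : r M C ≤ r M (C - e)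
    r[C]≤r[C-e] = ≤-pred (begin-strict
      r M C            <⟨ dep ⟩
      ∣ C ∣            ≤⟨ ∣p∣≤1+∣p-x∣ C e ⟩
      1 + ∣ C - e ∣    ≡⟨ cong suc (minimal (C - e) (x∈p⇒p-x⊂p e∈C)) ⟨
      1 + r M (C - e)  ∎)

  unionOfCircuits⇒r[X-e]≡r[X] : ∀ {X Y e} → IsUnionOfCircuits M Y → Y ⊆ X → e ∈ Y →
                                r M (X - e) ≡ r M X
  unionOfCircuits⇒r[X-e]≡r[X] cY Y⊆X e∈Y =
    let (C , circuit , e∈C , C⊆Y) = cY _ e∈Y in circuit⇒r[F-e]≡r[F] circuit e∈C (⊆-trans C⊆Y Y⊆X)

  r[X-e]≡r[X]⇒dependent : ∀ {X e} → e ∈ X → r M (X - e) ≡ r M X → IsDependent M X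
  r[X-e]≡r[X]⇒dependent {X} {e} e∈X r[X-e]≡r[X] = begin-strict
    r M X        ≡⟨ r[X-e]≡r[X] ⟨
    r M (X - e)  ≤⟨ r-bounded M (X - e) ⟩
    ∣ X - e ∣    <⟨ x∈p⇒∣p-x∣<∣p∣ e∈X ⟩
    ∣ X ∣        ∎
    where open ≤-Reasoning

  r[X-e]≡r[X]⇒circuit : ∀ {X e} → e ∈ X → r M (X - e) ≡ r M X →
                        ∃ λ C → IsCircuit M C × e ∈ C × C ⊆ X
  r[X-e]≡r[X]⇒circuit = go (⊂-wellFounded _)
    where
    go : ∀ {X e} → Acc _⊂_ X → e ∈ X → r M (X - e) ≡ r M X → ∃ λ C → IsCircuit M C × e ∈ C × C ⊆ X
    go {X} {e} (acc smaller) e∈X r[X-e]≡r[X] with ∃-circuit⊆ (r[X-e]≡r[X]⇒dependent e∈X r[X-e]≡r[X])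
    ... | C , circuit , C⊆X with e ∈? C
    ...   | yes e∈C = C , circuit , e∈C , C⊆X
    ...   | no e∉C =
      -- C lies in X - e, so deleting any f ∈ C from X keeps e spanned: recurse on X - f.
      let (C′ , circuit′ , e∈C′ , C′⊆X-f) = go (smaller (x∈p⇒p-x⊂p f∈X)) e∈X-f r[X-f-e]≡r[X-f]
      in C′ , circuit′ , e∈C′ , ⊆-trans C′⊆X-f (p─q⊆p X ⁅ f ⁆)
      where
      open ≤-Reasoning
      f : Fin n
      f = proj₁ (dependent⇒nonempty (proj₁ circuit))
      f∈C : f ∈ C
      f∈C = proj₂ (dependent⇒nonempty (proj₁ circuit))
      f∈X : f ∈ X
      f∈X = C⊆X f∈C
      e∈X-f : e ∈ X - f
      e∈X-f = x∈p∧x≢y⇒x∈p-y e∈X λ { refl → e∉C f∈C }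
      C⊆X-e : C ⊆ X - e
      C⊆X-e x∈C = x∈p∧x≢y⇒x∈p-y (C⊆X x∈C) λ { refl → e∉C x∈C }
      r[X-f-e]≡r[X-f] : r M (X - f - e) ≡ r M (X - f)
      r[X-f-e]≡r[X-f] = ≤-antisym (r-mono M _ _ (p─q⊆p (X - f) ⁅ e ⁆)) (begin
        r M (X - f)      ≤⟨ r-mono M _ _ (p─q⊆p X ⁅ f ⁆) ⟩
        r M X            ≡⟨ r[X-e]≡r[X] ⟨
        r M (X - e)      ≡⟨ circuit⇒r[F-e]≡r[F] circuit f∈C C⊆X-e ⟨
        r M (X - e - f)  ≡⟨ cong (r M) (p─x─y≡p─y─x X e f) ⟩
        r M (X - f - e)  ∎)

  unionOfCircuits-extend : ∀ {Z W} → IsUnionOfCircuits M Z → Z ⊆ W → r M W ≤ r M Z →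
                           IsUnionOfCircuits M W
  unionOfCircuits-extend {Z} {W} cZ Z⊆W r[W]≤r[Z] f f∈W with f ∈? Z
  ... | yes f∈Z = let (C , circuit , f∈C , C⊆Z) = cZ f f∈Z in C , circuit , f∈C , ⊆-trans C⊆Z Z⊆W
  ... | no f∉Z = r[X-e]≡r[X]⇒circuit f∈W
    (≤-antisym (r-mono M _ _ (p─q⊆p W ⁅ f ⁆)) (≤-trans r[W]≤r[Z] (r-mono M _ _ Z⊆W-f)))
    where
    Z⊆W-f : Z ⊆ W - f
    Z⊆W-f x∈Z = x∈p∧x≢y⇒x∈p-y (Z⊆W x∈Z) λ { refl → f∉Z x∈Z }

  unionOfCircuits-∪ : ∀ {X Y} → IsUnionOfCircuits M X → IsUnionOfCircuits M Y →
                      IsUnionOfCircuits M (X ∪ Y)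
  unionOfCircuits-∪ {X} {Y} cX cY e e∈X∪Y with x∈p∪q⁻ X Y e∈X∪Y
  ... | inj₁ e∈X = let (C , circuit , e∈C , C⊆X) = cX e e∈X in C , circuit , e∈C , ⊆-trans C⊆X (p⊆p∪q Y)
  ... | inj₂ e∈Y = let (C , circuit , e∈C , C⊆Y) = cY e e∈Y in C , circuit , e∈C , ⊆-trans C⊆Y (q⊆p∪q X Y)

  CyclicFlat : Set
  CyclicFlat = Σ (Subset n) (IsCyclicFlat M)

  isCyclicFlat? : ∀ F → Dec (IsCyclicFlat M F)
  isCyclicFlat? F = isFlat? ×-dec isUnionOfCircuits?
    where
    isFlat? : Dec (IsFlat M F)
    isFlat? = all? λ e → (r M (F ∪ ⁅ e ⁆) ≟ r M F) →-dec (e ∈? F)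
    isUnionOfCircuits? : Dec (IsUnionOfCircuits M F)
    isUnionOfCircuits? =
      map′ (λ noColoop e e∈F → r[X-e]≡r[X]⇒circuit e∈F (noColoop e e∈F))
           (λ cF e e∈F → unionOfCircuits⇒r[X-e]≡r[X] cF ⊆-refl e∈F)
           (all? λ e → e ∈? F →-dec (r M (F - e) ≟ r M F))

  cyclicFlats : List CyclicFlat
  cyclicFlats = enumerate isCyclicFlat?

  flat-absorbs : ∀ {F Z e} → IsFlat M F → Z ⊆ F → r M (Z ∪ ⁅ e ⁆) ≡ r M Z → e ∈ F
  flat-absorbs {F} {Z} {e} flat Z⊆F r[Z∪e]≡r[Z] =
    flat e (≤-antisym (+-cancelʳ-≤ (r M Z) _ _ (begin
      r M (F ∪ ⁅ e ⁆) + r M Z  ≤⟨ r-submod-⊆ F∪e⊆F∪[Z∪e] Z⊆F∩[Z∪e] ⟩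
      r M F + r M (Z ∪ ⁅ e ⁆)  ≡⟨ cong (r M F +_) r[Z∪e]≡r[Z] ⟩
      r M F + r M Z            ∎)) (r-mono M _ _ (p⊆p∪q ⁅ e ⁆)))
    where
    open ≤-Reasoning
    F∪e⊆F∪[Z∪e] : F ∪ ⁅ e ⁆ ⊆ F ∪ (Z ∪ ⁅ e ⁆)
    F∪e⊆F∪[Z∪e] x∈F∪e =
      [ p⊆p∪q (Z ∪ ⁅ e ⁆) , q⊆p∪q F (Z ∪ ⁅ e ⁆) ∘ q⊆p∪q Z ⁅ e ⁆ ]′ (x∈p∪q⁻ F ⁅ e ⁆ x∈F∪e)
    Z⊆F∩[Z∪e] : Z ⊆ F ∩ (Z ∪ ⁅ e ⁆)
    Z⊆F∩[Z∪e] x∈Z = x∈p∩q⁺ (Z⊆F x∈Z , p⊆p∪q ⁅ e ⁆ x∈Z)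

  flat-∩ : ∀ {F G} → IsFlat M F → IsFlat M G → IsFlat M (F ∩ G)
  flat-∩ {F} {G} flatF flatG e r[F∩G∪e]≡r[F∩G] =
    x∈p∩q⁺ (flat-absorbs flatF (p∩q⊆p F G) r[F∩G∪e]≡r[F∩G] ,
            flat-absorbs flatG (p∩q⊆q F G) r[F∩G∪e]≡r[F∩G])

  unionOfCircuits-avoids-coloop : ∀ {X Y e} → IsUnionOfCircuits M Y → Y ⊆ X →
                                  r M (X - e) ≢ r M X → Y ⊆ X - e
  unionOfCircuits-avoids-coloop cY Y⊆X coloop y∈Y =
    x∈p∧x≢y⇒x∈p-y (Y⊆X y∈Y) λ { refl → coloop (unionOfCircuits⇒r[X-e]≡r[X] cY Y⊆X y∈Y) }

  delete-coloops : ∀ {X Y} → Y ⊆ X → IsUnionOfCircuits M Y →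
                   ∃ λ Z → IsUnionOfCircuits M Z × Y ⊆ Z × Z ⊆ X × r M Z + ∣ X ─ Z ∣ ≤ r M X
  delete-coloops = go (⊂-wellFounded _)
    where
    go : ∀ {X Y} → Acc _⊂_ X → Y ⊆ X → IsUnionOfCircuits M Y →
         ∃ λ Z → IsUnionOfCircuits M Z × Y ⊆ Z × Z ⊆ X × r M Z + ∣ X ─ Z ∣ ≤ r M X
    go {X} {Y} (acc smaller) Y⊆X cY with any? (λ e → e ∈? X ×-dec ¬? (r M (X - e) ≟ r M X))
    ... | no ∄coloop = X , cX , Y⊆X , ⊆-refl ,
                       ≤-reflexive (trans (cong (r M X +_) (∣p─p∣≡0 X)) (+-identityʳ (r M X)))
      where
      cX : IsUnionOfCircuits M X
      cX e e∈X = r[X-e]≡r[X]⇒circuit e∈X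
        (decidable-stable (r M (X - e) ≟ r M X) λ coloop → ∄coloop (e , e∈X , coloop))
    ... | yes (e , e∈X , coloop)
      with (Z , cZ , Y⊆Z , Z⊆X-e , bound) ← go (smaller (x∈p⇒p-x⊂p e∈X))
                                                 (unionOfCircuits-avoids-coloop cY Y⊆X coloop) cY
      = Z , cZ , Y⊆Z , ⊆-trans Z⊆X-e (p─q⊆p X ⁅ e ⁆) , (begin
        r M Z + ∣ X ─ Z ∣            ≤⟨ +-monoʳ-≤ (r M Z) (∣p∣≤1+∣p-x∣ (X ─ Z) e) ⟩
        r M Z + (1 + ∣ X ─ Z - e ∣)  ≡⟨ +-suc (r M Z) _ ⟩
        1 + (r M Z + ∣ X ─ Z - e ∣)  ≡⟨ cong (λ D → 1 + (r M Z + ∣ D ∣)) (p─q─r≡p─r─q X Z ⁅ e ⁆) ⟩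
        1 + (r M Z + ∣ X - e ─ Z ∣)  ≤⟨ s≤s bound ⟩
        1 + r M (X - e)              ≤⟨ ≤∧≢⇒< (r-mono M _ _ (p─q⊆p X ⁅ e ⁆)) coloop ⟩
        r M X                        ∎)
      where open ≤-Reasoning

  cyclic-closure : ∀ {Z} → IsUnionOfCircuits M Z →
                   ∃ λ C → IsCyclicFlat M C × Z ⊆ C × r M C ≡ r M Z ×
                           (∀ {F} → IsFlat M F → Z ⊆ F → C ⊆ F)
  cyclic-closure = go (⊃-wellFounded _)
    where
    go : ∀ {Z} → Acc _⊃_ Z → IsUnionOfCircuits M Z →
         ∃ λ C → IsCyclicFlat M C × Z ⊆ C × r M C ≡ r M Z × (∀ {F} → IsFlat M F → Z ⊆ F → C ⊆ F)
    go {Z} (acc larger) cZ with any? (λ e → ¬? (e ∈? Z) ×-dec (r M (Z ∪ ⁅ e ⁆) ≟ r M Z))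
    ... | no ∄spanned = Z , (flat , cZ) , ⊆-refl , refl , λ _ Z⊆F → Z⊆F
      where
      flat : IsFlat M Z
      flat e r[Z∪e]≡r[Z] = decidable-stable (e ∈? Z) λ e∉Z → ∄spanned (e , e∉Z , r[Z∪e]≡r[Z])
    ... | yes (e , e∉Z , r[Z∪e]≡r[Z])
      with (C , cC , Z∪e⊆C , r[C]≡r[Z∪e] , least) ←
             go (larger (p⊆p∪q ⁅ e ⁆ , e , q⊆p∪q Z ⁅ e ⁆ (x∈⁅x⁆ e) , e∉Z))
                (unionOfCircuits-extend cZ (p⊆p∪q ⁅ e ⁆) (≤-reflexive r[Z∪e]≡r[Z]))
      = C , cC , ⊆-trans (p⊆p∪q ⁅ e ⁆) Z∪e⊆C , trans r[C]≡r[Z∪e] r[Z∪e]≡r[Z] ,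
        λ flat Z⊆F → least flat (Z∪e⊆F flat Z⊆F)
      where
      Z∪e⊆F : ∀ {F} → IsFlat M F → Z ⊆ F → Z ∪ ⁅ e ⁆ ⊆ F
      Z∪e⊆F {F} flat Z⊆F x∈Z∪e = [ Z⊆F , (λ x∈⁅e⁆ → subst (_∈ F) (sym (x∈⁅y⁆⇒x≡y e x∈⁅e⁆)) e∈F) ]′
                                   (x∈p∪q⁻ Z ⁅ e ⁆ x∈Z∪e)
        where
        e∈F : e ∈ F
        e∈F = flat-absorbs flat Z⊆F r[Z∪e]≡r[Z]

  cyclicFlat-core : ∀ {X Y} → Y ⊆ X → IsUnionOfCircuits M Y →
                    ∃ λ C → IsCyclicFlat M C × Y ⊆ C × (∀ {F} → IsFlat M F → X ⊆ F → C ⊆ F) ×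
                            r M C + ∣ X ─ C ∣ ≤ r M X
  cyclicFlat-core {X} Y⊆X cY
    with (Z , cZ , Y⊆Z , Z⊆X , bound) ← delete-coloops Y⊆X cY
    with (C , cC , Z⊆C , r[C]≡r[Z] , least) ← cyclic-closure cZ
    = C , cC , ⊆-trans Y⊆Z Z⊆C , (λ flat X⊆F → least flat (⊆-trans Z⊆X X⊆F)) , (begin
      r M C + ∣ X ─ C ∣  ≤⟨ +-mono-≤ (≤-reflexive r[C]≡r[Z]) (p⊆q⇒∣p∣≤∣q∣ (q⊆s⇒p─s⊆p─q {p = X} Z⊆C)) ⟩
      r M Z + ∣ X ─ Z ∣  ≤⟨ bound ⟩
      r M X              ∎)
    where open ≤-Reasoning

  rank-witness : ∀ X → ∃ λ F → IsCyclicFlat M F × r M F + ∣ X ─ F ∣ ≤ r M X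
  rank-witness X =
    let (F , cF , _ , _ , bound) = cyclicFlat-core (⊥⊆ {p = X}) (λ e e∈⊥ → ⊥-elim (∉⊥ e∈⊥))
    in F , cF , bound

-- Configurations

module _ (M N : Matroid n) (σ : Permutation n n) where

  r-image≤ : (∀ F → IsCyclicFlat M F → r N (image σ F) ≤ r M F) → ∀ X → r N (image σ X) ≤ r M X
  r-image≤ image-rank≤ X
    with (F , cF , bound) ← rank-witness M X
    = begin
      r N (image σ X)                              ≤⟨ r≤r+∣─∣ N (image σ X) (image σ F) ⟩
      r N (image σ F) + ∣ image σ X ─ image σ F ∣  ≡⟨ cong (r N (image σ F) +_) (∣image-─∣ σ X F) ⟩
      r N (image σ F) + ∣ X ─ F ∣                  ≤⟨ +-monoˡ-≤ ∣ X ─ F ∣ (image-rank≤ F cF) ⟩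
      r M F + ∣ X ─ F ∣                            ≤⟨ bound ⟩
      r M X                                        ∎
    where open ≤-Reasoning

  r≤r-image : (∀ G → IsCyclicFlat N G → ∃ λ F → image σ F ≡ G × r M F ≤ r N G) →
              ∀ X → r M X ≤ r N (image σ X)
  r≤r-image preimage X
    with (G , cG , bound) ← rank-witness N (image σ X)
    with (F , σF≡G , r[F]≤r[G]) ← preimage G cG
    = begin
      r M X                              ≤⟨ r≤r+∣─∣ M X F ⟩
      r M F + ∣ X ─ F ∣                  ≡⟨ cong (r M F +_) (∣image-─∣ σ X F) ⟨
      r M F + ∣ image σ X ─ image σ F ∣
        ≤⟨ +-mono-≤ r[F]≤r[G] (≤-reflexive (cong (λ H → ∣ image σ X ─ H ∣) σF≡G)) ⟩
      r N G + ∣ image σ X ─ G ∣          ≤⟨ bound ⟩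
      r N (image σ X)                    ∎
    where open ≤-Reasoning

module _ {M N : Matroid n} (Z : ConfigIso M N) where
  open ConfigIso Z

  Ψ-rank : ∀ {G} → IsCyclicFlat N G → r M (Ψ G) ≡ r N G
  Ψ-rank {G} cG = trans (sym (Φ-rank (Ψ G) (Ψ-cyc G cG))) (cong (r N) (ΦΨ G cG))

  Φ⊆⇒⊆Ψ : ∀ {A G} → IsCyclicFlat M A → IsCyclicFlat N G → Φ A ⊆ G → A ⊆ Ψ G
  Φ⊆⇒⊆Ψ {A} {G} cA cG ΦA⊆G = subst (_⊆ Ψ G) (ΨΦ A cA) (Ψ-mono (Φ A) G (Φ-cyc A cA) cG ΦA⊆G)

  ⊆Φ⇒Ψ⊆ : ∀ {A G} → IsCyclicFlat M A → IsCyclicFlat N G → G ⊆ Φ A → Ψ G ⊆ A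
  ⊆Φ⇒Ψ⊆ {A} {G} cA cG G⊆ΦA = subst (Ψ G ⊆_) (ΨΦ A cA) (Ψ-mono G (Φ A) cG (Φ-cyc A cA) G⊆ΦA)

  Ψ⊆⇒⊆Φ : ∀ {A G} → IsCyclicFlat M A → IsCyclicFlat N G → Ψ G ⊆ A → G ⊆ Φ A
  Ψ⊆⇒⊆Φ {A} {G} cA cG ΨG⊆A = subst (_⊆ Φ A) (ΦΨ G cG) (Φ-mono (Ψ G) A (Ψ-cyc G cG) cA ΨG⊆A)

  r[A∪B]≤r[ΦA∪ΦB] : ∀ {A B} → IsCyclicFlat M A → IsCyclicFlat M B → r M (A ∪ B) ≤ r N (Φ A ∪ Φ B)
  r[A∪B]≤r[ΦA∪ΦB] {A} {B} cA cB
    with (J , cJ , ΦA∪ΦB⊆J , _ , bound) ←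
           cyclicFlat-core N ⊆-refl (unionOfCircuits-∪ N (proj₂ (Φ-cyc A cA)) (proj₂ (Φ-cyc B cB)))
    = begin
      r M (A ∪ B)                  ≤⟨ r-mono M _ _ A∪B⊆ΨJ ⟩
      r M (Ψ J)                    ≡⟨ Ψ-rank cJ ⟩
      r N J                        ≤⟨ m≤m+n (r N J) _ ⟩
      r N J + ∣ (Φ A ∪ Φ B) ─ J ∣  ≤⟨ bound ⟩
      r N (Φ A ∪ Φ B)              ∎
    where
    open ≤-Reasoning
    A∪B⊆ΨJ : A ∪ B ⊆ Ψ J
    A∪B⊆ΨJ x∈A∪B = [ Φ⊆⇒⊆Ψ cA cJ (⊆-trans (p⊆p∪q (Φ B)) ΦA∪ΦB⊆J) ,
                     Φ⊆⇒⊆Ψ cB cJ (⊆-trans (q⊆p∪q (Φ A) (Φ B)) ΦA∪ΦB⊆J) ]′ (x∈p∪q⁻ A B x∈A∪B)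

  Φ[A∩B]⊆ΦA∩ΦB : ∀ {A B} → IsCyclicFlat M A → IsCyclicFlat M B → IsCyclicFlat M (A ∩ B) →
                  Φ (A ∩ B) ⊆ Φ A ∩ Φ B
  Φ[A∩B]⊆ΦA∩ΦB {A} {B} cA cB cA∩B x∈ =
    x∈p∩q⁺ (Φ-mono (A ∩ B) A cA∩B cA (p∩q⊆p A B) x∈ , Φ-mono (A ∩ B) B cA∩B cB (p∩q⊆q A B) x∈)

  Φ-∩ : ∀ {A B} → IsCyclicFlat M A → IsCyclicFlat M B → IsModularPair M A B →
        IsCyclicFlat M (A ∩ B) → Φ (A ∩ B) ≡ Φ A ∩ Φ B
  Φ-∩ {A} {B} cA cB modular cA∩B
    with (C , cC , ΦA∩B⊆C , C⊆flats , bound) ←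
           cyclicFlat-core N (Φ[A∩B]⊆ΦA∩ΦB cA cB cA∩B) (proj₂ (Φ-cyc (A ∩ B) cA∩B))
    = ⊆-antisym (Φ[A∩B]⊆ΦA∩ΦB cA cB cA∩B) (⊆-trans ΦA∩ΦB⊆C C⊆ΦA∩B)
    where
    open ≤-Reasoning
    C⊆ΦA∩ΦB : C ⊆ Φ A ∩ Φ B
    C⊆ΦA∩ΦB = C⊆flats (flat-∩ N (proj₁ (Φ-cyc A cA)) (proj₁ (Φ-cyc B cB))) ⊆-refl
    C⊆ΦA∩B : C ⊆ Φ (A ∩ B)
    C⊆ΦA∩B = Ψ⊆⇒⊆Φ cA∩B cC λ x∈ΨC →
      x∈p∩q⁺ (⊆Φ⇒Ψ⊆ cA cC (⊆-trans C⊆ΦA∩ΦB (p∩q⊆p (Φ A) (Φ B))) x∈ΨC ,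
              ⊆Φ⇒Ψ⊆ cB cC (⊆-trans C⊆ΦA∩ΦB (p∩q⊆q (Φ A) (Φ B))) x∈ΨC)
    r[ΦA∩ΦB]≤r[ΦA∩B] : r N (Φ A ∩ Φ B) ≤ r N (Φ (A ∩ B))
    r[ΦA∩ΦB]≤r[ΦA∩B] = +-cancelˡ-≤ (r M (A ∪ B)) (r N (Φ A ∩ Φ B)) (r N (Φ (A ∩ B))) (begin
      r M (A ∪ B) + r N (Φ A ∩ Φ B)      ≤⟨ +-monoˡ-≤ (r N (Φ A ∩ Φ B)) (r[A∪B]≤r[ΦA∪ΦB] cA cB) ⟩
      r N (Φ A ∪ Φ B) + r N (Φ A ∩ Φ B)  ≤⟨ r-submod N (Φ A) (Φ B) ⟩
      r N (Φ A) + r N (Φ B)              ≡⟨ cong₂ _+_ (Φ-rank A cA) (Φ-rank B cB) ⟩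
      r M A + r M B                      ≡⟨ modular ⟩
      r M (A ∪ B) + r M (A ∩ B)          ≡⟨ cong (r M (A ∪ B) +_) (Φ-rank (A ∩ B) cA∩B) ⟨
      r M (A ∪ B) + r N (Φ (A ∩ B))      ∎)
    ΦA∩ΦB⊆C : Φ A ∩ Φ B ⊆ C
    ΦA∩ΦB⊆C = ∣p─q∣≡0⇒p⊆q {p = Φ A ∩ Φ B} {C}
      (n≤0⇒n≡0 (+-cancelˡ-≤ (r N C) ∣ Φ A ∩ Φ B ─ C ∣ 0 (begin
      r N C + ∣ Φ A ∩ Φ B ─ C ∣  ≤⟨ bound ⟩
      r N (Φ A ∩ Φ B)            ≤⟨ r[ΦA∩ΦB]≤r[ΦA∩B] ⟩
      r N (Φ (A ∩ B))            ≤⟨ r-mono N _ _ ΦA∩B⊆C ⟩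
      r N C                      ≡⟨ +-identityʳ (r N C) ⟨
      r N C + 0                  ∎)))

  cyclicFlat-permutation :
    (∀ A B → IsCyclicFlat M A → IsCyclicFlat M B → IsModularPair M A B × IsCyclicFlat M (A ∩ B)) →
    Σ (Permutation n n) λ σ → ∀ F → IsCyclicFlat M F → image σ F ≡ Φ F
  cyclicFlat-permutation modular-meets =
    proj₁ permutation , λ F cF → proj₂ permutation (proj₂ (∈-enumerate (isCyclicFlat? M) cF))
    where
    _⊓_ : CyclicFlat M → CyclicFlat M → CyclicFlat M
    (F , cF) ⊓ (G , cG) = F ∩ G , proj₂ (modular-meets F G cF cG)
    Φ-⊓ : ∀ F G → Φ (proj₁ (F ⊓ G)) ≡ Φ (proj₁ F) ∩ Φ (proj₁ G)
    Φ-⊓ (F , cF) (G , cG) = let (modular , cF∩G) = modular-meets F G cF cG in Φ-∩ cF cG modular cF∩G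
    ∣F∣≡∣ΦF∣ : ∀ F → ∣ proj₁ F ∣ ≡ ∣ Φ (proj₁ F) ∣
    ∣F∣≡∣ΦF∣ (F , cF) = sym (Φ-size F cF)
    permutation : Σ (Permutation n n) λ σ →
                    ∀ {F} → F ∈ₗ cyclicFlats M → image σ (proj₁ F) ≡ Φ (proj₁ F)
    permutation = atom-permutation proj₁ (Φ ∘ proj₁)
                    (∣⋂∣-equal _⊓_ proj₁ (Φ ∘ proj₁) (λ _ _ → refl) Φ-⊓ ∣F∣≡∣ΦF∣)
                    (cyclicFlats M)

theorem6p1 : (n : ℕ) (M : Matroid n) →
    (∀ A B → IsCyclicFlat M A → IsCyclicFlat M B →
      IsModularPair M A B × IsCyclicFlat M (A ∩ B)) →
    ConfigurationUnique M
theorem6p1 n M modular-meets .n N (refl , Z) =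
  σ , λ X → ≤-antisym (r-image≤ M N σ image-rank≤ X) (r≤r-image M N σ preimage X)
  where
  open ConfigIso Z
  permutation : Σ (Permutation n n) λ σ → ∀ F → IsCyclicFlat M F → image σ F ≡ Φ F
  permutation = cyclicFlat-permutation Z modular-meets
  σ : Permutation n n
  σ = proj₁ permutation
  image-rank≤ : ∀ F → IsCyclicFlat M F → r N (image σ F) ≤ r M F
  image-rank≤ F cF = ≤-reflexive (trans (cong (r N) (proj₂ permutation F cF)) (Φ-rank F cF))
  preimage : ∀ G → IsCyclicFlat N G → ∃ λ F → image σ F ≡ G × r M F ≤ r N G
  preimage G cG =
    Ψ G , trans (proj₂ permutation (Ψ G) (Ψ-cyc G cG)) (ΦΨ G cG) , ≤-reflexive (Ψ-rank Z cG)
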